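{- Let $G$ be a Lehman graph of type $(n,3,s)$ with $k=3s-n\in\{1,-1\}$, and assume $s>2$ if $k=1$ and $s>1$ if $k=-1$. Suppose $G$ contains a $3$-rung ladder segment $L$, with vertices and outside neighbours $b_0,b_1,b_2,w_0,w_1,w_2,w_L,b_L,w_R,b_R$ labelled as in the context. Let $G{\downarrow}L$ be the graph obtained from $G$ by deleting the six vertices $b_0,b_1,b_2,w_0,w_1,w_2$ of $L$ and adding the edges $b_Lw_R$ and $w_Lb_R$. Then $G{\downarrow}L$ is a Lehman graph of type $(n-3,3,s-1)$.
   Context: A bipartite graph $G$ with $n$ black and $n$ white vertices has bipartite adjacency matrix $A$ (rows indexed by black vertices, columns by white vertices, entry $1$ iff adjacent). A matrix is $r$-regular if all row and column sums equal $r$. $G$ is a Lehman graph of type $(n,r,s)$ if $A$ is $r$-regular and there is an $s$-regular $n\times n$ $(0,1)$-matrix $B$ with $AB^T=J+kI$, where $k=rs-n\in\{ -1,1,2,3,\ldots\}$, $J$ is the all-ones matrix and $I$ the identity. A $3$-rung ladder segment in a cubic bipartite graph is a $6$-vertex induced subgraph isomorphic to the cube $Q_3$ with two adjacent vertices deleted; its vertices are labelled black $b_0,b_1,b_2$ and white $w_0,w_1,w_2$, with its seven edges $b_0w_0,b_1w_1,b_2w_2,b_0w_1,b_2w_1,b_1w_0,b_1w_2$. In the cubic graph, each of $b_0,w_0,b_2,w_2$ has exactly one neighbour outside $L$: $w_L$ is the outside neighbour of $b_0$, $b_L$ that of $w_0$, $w_R$ that of $b_2$, and $b_R$ that of $w_2$.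 -}

module Defs where

open import Data.Nat using (ℕ; zero; suc; _+_; _*_; _∸_; _<_)
open import Data.Integer as ℤ using (ℤ; +_; -[1+_]; _-_)
open import Data.Fin using (Fin; zero; suc; _≟_)
open import Data.Bool using (Bool; true; false; if_then_else_; _∨_; _∧_)
open import Data.Product using (Σ; ∃; _×_; _,_)
open import Data.Sum using (_⊎_)
open import Relation.Binary.PropositionalEquality using (_≡_; _≢_)
open import Relation.Nullary.Decidable using (⌊_⌋)

∑ : (n : ℕ) → (Fin n → ℕ) → ℕ
∑ zero    f = 0
∑ (suc n) f = f zero + ∑ n (λ i → f (suc i))

-- n × n matrices with natural-number entries (rows = black, columns = white).
Mat : ℕ → Set
Mat n = Fin n → Fin n → ℕ

IsZeroOne : {n : ℕ} → Mat n → Set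
IsZeroOne A = ∀ i j → (A i j ≡ 0) ⊎ (A i j ≡ 1)

IsRegular : (n r : ℕ) → Mat n → Set
IsRegular n r A = (∀ i → ∑ n (λ j → A i j) ≡ r) × (∀ j → ∑ n (λ i → A i j) ≡ r)

kOf : (n r s : ℕ) → ℤ
kOf n r s = + (r * s) - + n

AdmissibleK : ℤ → Set
AdmissibleK k = (k ≡ -[1+ 0 ]) ⊎ Σ ℕ (λ m → k ≡ + suc m)

ABt : {n : ℕ} → Mat n → Mat n → Fin n → Fin n → ℕ
ABt {n} A B i j = ∑ n (λ l → A i l * B j l)

IsJplusKI : (n : ℕ) → ℤ → Mat n → Mat n → Set
IsJplusKI n k A B =
  (∀ i → + (ABt A B i i) ≡ + 1 ℤ.+ k) ×
  (∀ i j → i ≢ j → ABt A B i j ≡ 1)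

-- G (given by its bipartite adjacency matrix A) is a Lehman graph of type (n,r,s)
IsLehman : (n r s : ℕ) → Mat n → Set
IsLehman n r s A =
  IsZeroOne A × IsRegular n r A × AdmissibleK (kOf n r s) ×
  Σ (Mat n) (λ B → IsZeroOne B × IsRegular n s B × IsJplusKI n (kOf n r s) A B)

Distinct3 : {n : ℕ} → Fin n → Fin n → Fin n → Set
Distinct3 x y z = x ≢ y × x ≢ z × y ≢ z

NotIn3 : {n : ℕ} → Fin n → Fin n → Fin n → Fin n → Set
NotIn3 v x y z = v ≢ x × v ≢ y × v ≢ z

IsLadder : {n : ℕ} → Mat n → (b0 b1 b2 w0 w1 w2 : Fin n) → Set
IsLadder A b0 b1 b2 w0 w1 w2 =
  Distinct3 b0 b1 b2 × Distinct3 w0 w1 w2 ×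
  A b0 w0 ≡ 1 × A b1 w1 ≡ 1 × A b2 w2 ≡ 1 ×
  A b0 w1 ≡ 1 × A b2 w1 ≡ 1 × A b1 w0 ≡ 1 × A b1 w2 ≡ 1 ×
  A b0 w2 ≡ 0 × A b2 w0 ≡ 0

EnumeratesComplement : {m n : ℕ} → (Fin m → Fin n) → Fin n → Fin n → Fin n → Set
EnumeratesComplement f x y z =
  (∀ i j → f i ≡ f j → i ≡ j) ×
  (∀ v → (∃ λ i → f i ≡ v) → NotIn3 v x y z) ×
  (∀ v → NotIn3 v x y z → ∃ λ i → f i ≡ v)

-- Adjacency matrix of G↓L, with remaining black vertices enumerated by f and
-- remaining white vertices by g; the edges bL wR and bR wL are added.
reduce : {m n : ℕ} → Mat n → (f g : Fin m → Fin n) → (bL wR bR wL : Fin n) → Mat m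
reduce A f g bL wR bR wL i j =
  if (⌊ f i ≟ bL ⌋ ∧ ⌊ g j ≟ wR ⌋) ∨ (⌊ f i ≟ bR ⌋ ∧ ⌊ g j ≟ wL ⌋)
  then 1 else A (f i) (g j)

module Submission where

-- Row b1 of A is {w0, w1, w2}, so ABᵀ = J + kI says that every black vertex q outside L
-- has exactly one B-neighbour among w0, w1, w2; comparing with the rows of b0 and b2 gives
-- B q wL = B q w2 and B q wR = B q w0.  Since A is invertible, ABᵀ = J + kI also gives
-- BᵀA = J + kI, and the column of w1 shows that every white vertex outside L has exactly
-- one B-neighbour among b0, b1, b2.  Hence deleting L lowers every line sum of B by one,
-- and in the product of the reduced matrices the lost contributions of w0 and w2 are
-- exactly replaced by those of the new edges bL wR and bR wL.  These new edges are not
-- already edges of G and are distinct: otherwise some black vertex x outside L has two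
-- neighbours that B cannot distinguish from a white vertex wX outside L, and then the
-- column of wX in B sums to at most 1 + (1 + k)/2 < s.

open import Defs
open import Algebra.Bundles using (CommutativeMonoid)
open import Data.Bool.Base using (Bool; true; false; T; _∧_; _∨_; if_then_else_)
open import Data.Bool.Properties using (T-∧; T-∨)
open import Data.Empty using (⊥; ⊥-elim)
open import Data.Fin.Base using (Fin; zero; suc; punchIn; punchOut)
open import Data.Fin.Properties
  using (_≟_; all?; ¬∀⟶∃¬; punchIn-injective; punchInᵢ≢i; punchIn-punchOut; punchOut-injective)
open import Data.Nat.Base using (ℕ; zero; suc)
open import Data.Product.Base as Product using (Σ; ∃; _×_; _,_; proj₁; proj₂)
open import Data.Sum.Base using (_⊎_; inj₁; inj₂)
open import Data.Vec.Functional using (Vector; insertAt)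
open import Data.Vec.Functional.Properties using (insertAt-lookup; insertAt-punchIn)
open import Function.Base using (_∘_; flip)
open import Function.Bundles using (Equivalence)
open import Relation.Binary.PropositionalEquality
  using (_≡_; _≢_; refl; sym; trans; cong; cong₂; subst; ≢-sym; module ≡-Reasoning)
open import Relation.Nullary.Decidable using (yes; no; ⌊_⌋; toWitness; isYes≗does; dec-true; dec-false)
open import Relation.Nullary.Negation using (¬_; contradiction)

module _ {a ℓ} (M : CommutativeMonoid a ℓ) where

  open CommutativeMonoid M renaming (ε to 0#)
  open import Algebra.Properties.CommutativeMonoid.Sum M using (sum; sum-remove; sum-cong-≋; sum-replicate-zero)
  open import Relation.Binary.Reasoning.Setoid setoid

  sum-single : ∀ {n} (f : Vector Carrier n) i → (∀ j → j ≢ i → f j ≈ 0#) → sum f ≈ f i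
  sum-single {suc n} f i f≈0 = begin
    sum f                      ≈⟨ sum-remove f ⟩
    f i ∙ sum (f ∘ punchIn i)  ≈⟨ ∙-congˡ (sum-cong-≋ {n} (λ j → f≈0 (punchIn i j) (punchInᵢ≢i i j))) ⟩
    f i ∙ sum {n} (λ _ → 0#)   ≈⟨ ∙-congˡ (sum-replicate-zero n) ⟩
    f i ∙ 0#                   ≈⟨ identityʳ (f i) ⟩
    f i                        ∎

module _ {a} {A : Set a} (x y : A) where

  if-≟-refl : ∀ {n} (p : Fin n) → (if ⌊ p ≟ p ⌋ then x else y) ≡ x
  if-≟-refl p = cong (if_then x else y) (trans (isYes≗does (p ≟ p)) (dec-true (p ≟ p) refl))

  if-≟-≢ : ∀ {n} {p q : Fin n} → p ≢ q → (if ⌊ p ≟ q ⌋ then x else y) ≡ y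
  if-≟-≢ {p = p} {q} p≢q = cong (if_then x else y) (trans (isYes≗does (p ≟ q)) (dec-false (p ≟ q) p≢q))

module IntegerMatrices where

  open import Data.Nat.Base using (_<_; s≤s)
  import Data.Nat.Properties as ℕ
  open import Data.Integer.Base using (ℤ; +_; 0ℤ; 1ℤ; -_; _+_; _*_; _-_)
  import Data.Integer.Properties as ℤ
  open import Data.Integer.Tactic.RingSolver using (solve-∀)
  open import Algebra.Properties.Semiring.Sum ℤ.+-*-semiring
    using (sum; sum-remove; sum-cong-≗; sum-replicate-zero; ∑-distrib-+; ∑-comm; *-distribˡ-sum; *-distribʳ-sum)
  open ≡-Reasoning

  private
    variable
      m n d : ℕ

  infix 7 _·_
  _·_ : Vector ℤ n → Vector ℤ n → ℤ
  u · v = sum (λ i → u i * v i)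

  i*j≡0∧i≢0⇒j≡0 : ∀ {i j} → i * j ≡ 0ℤ → i ≢ 0ℤ → j ≡ 0ℤ
  i*j≡0∧i≢0⇒j≡0 {i} ij≡0 i≢0 with ℤ.i*j≡0⇒i≡0∨j≡0 i ij≡0
  ... | inj₁ i≡0 = contradiction i≡0 i≢0
  ... | inj₂ j≡0 = j≡0

  sum-const : ∀ n c → sum {n} (λ _ → c) ≡ + n * c
  sum-const zero    c = sym (ℤ.*-zeroˡ c)
  sum-const (suc n) c = trans (cong (_+_ c) (sum-const n c)) (sym (ℤ.suc-* (+ n) c))

  ·-comm : (u v : Vector ℤ n) → u · v ≡ v · u
  ·-comm u v = sum-cong-≗ (λ i → ℤ.*-comm (u i) (v i))

  ·-distrib-− : (u v w : Vector ℤ n) → u · (λ i → v i - w i) ≡ u · v - u · w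
  ·-distrib-− {n} u v w = begin
    sum (λ i → u i * (v i - w i))                 ≡⟨ sum-cong-≗ (λ i → expand (u i) (v i) (w i)) ⟩
    sum (λ i → u i * v i + (- 1ℤ) * (u i * w i))  ≡⟨ ∑-distrib-+ (λ i → u i * v i) (λ i → (- 1ℤ) * (u i * w i)) ⟩
    u · v + sum (λ i → (- 1ℤ) * (u i * w i))      ≡⟨ cong (_+_ (u · v)) (*-distribˡ-sum {n} (- 1ℤ) (λ i → u i * w i)) ⟨
    u · v + (- 1ℤ) * (u · w)                      ≡⟨ collect (u · v) (u · w) ⟩
    u · v - u · w                                 ∎
    where
    expand : ∀ a b c → a * (b - c) ≡ a * b + (- 1ℤ) * (a * c)
    expand = solve-∀
    collect : ∀ a b → a + (- 1ℤ) * b ≡ a - b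
    collect = solve-∀

  ·-assoc : (y : Vector ℤ m) (M : Fin m → Fin n → ℤ) (x : Vector ℤ n) →
            (λ t → y · (λ i → M i t)) · x ≡ y · (λ i → M i · x)
  ·-assoc y M x = begin
    sum (λ t → sum (λ i → y i * M i t) * x t)  ≡⟨ sum-cong-≗ (λ t → *-distribʳ-sum (x t) (λ i → y i * M i t)) ⟩
    sum (λ t → sum (λ i → y i * M i t * x t))  ≡⟨ ∑-comm (λ t i → y i * M i t * x t) ⟩
    sum (λ i → sum (λ t → y i * M i t * x t))  ≡⟨ sum-cong-≗ (λ i → pull (y i) (λ t → M i t) x) ⟩
    sum (λ i → y i * (M i · x))                ∎
    where
    pull : ∀ {n} c (u v : Vector ℤ n) → sum (λ t → c * u t * v t) ≡ c * (u · v)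
    pull {n} c u v = trans (sum-cong-≗ (λ t → ℤ.*-assoc c (u t) (v t))) (sym (*-distribˡ-sum {n} c (λ t → u t * v t)))

  ·-insertAt : ∀ (c : Vector ℤ m) i x (w : Vector ℤ (suc m)) → insertAt c i x · w ≡ x * w i + c · (w ∘ punchIn i)
  ·-insertAt c i x w = trans (sum-remove (λ j → insertAt c i x j * w j))
    (cong₂ _+_ (cong (_* w i) (insertAt-lookup c i x))
               (sum-cong-≗ (λ j → cong (_* w (punchIn i j)) (insertAt-punchIn c i x j))))

  unit-· : ∀ (t₀ : Fin n) (x : Vector ℤ n) → (λ t → if ⌊ t ≟ t₀ ⌋ then 1ℤ else 0ℤ) · x ≡ x t₀
  unit-· t₀ x = trans (sum-single ℤ.+-0-commutativeMonoid _ t₀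
                        (λ t t≢t₀ → trans (cong (_* x t) (if-≟-≢ 1ℤ 0ℤ t≢t₀)) (ℤ.*-zeroˡ (x t))))
                      (trans (cong (_* x t₀) (if-≟-refl 1ℤ 0ℤ t₀)) (ℤ.*-identityˡ (x t₀)))

  Dependent : (Fin m → Fin d → ℤ) → Set
  Dependent {m} v = ∃ λ (c : Vector ℤ m) → (∃ λ i → c i ≢ 0ℤ) × ∀ t → c · (λ i → v i t) ≡ 0ℤ

  dependent-tail : (v : Fin m → Fin (suc d) → ℤ) → (∀ i → v i zero ≡ 0ℤ) →
                   Dependent (λ i t → v i (suc t)) → Dependent v
  dependent-tail {m} v v₀≡0 (c , c≢0 , cv≡0) = c , c≢0 , λ
    { zero    → trans (sum-cong-≗ (λ i → trans (cong (c i *_) (v₀≡0 i)) (ℤ.*-zeroʳ (c i)))) (sum-replicate-zero m)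
    ; (suc t) → cv≡0 t
    }

  eliminate : (v : Fin (suc m) → Fin (suc d) → ℤ) → Fin (suc m) → Fin m → Fin (suc d) → ℤ
  eliminate v i₀ j t = v i₀ zero * v (punchIn i₀ j) t - v (punchIn i₀ j) zero * v i₀ t

  dependent-eliminate : (v : Fin (suc m) → Fin (suc d) → ℤ) (i₀ : Fin (suc m)) → v i₀ zero ≢ 0ℤ →
                        Dependent (λ j t → eliminate v i₀ j (suc t)) → Dependent v
  dependent-eliminate {m} v i₀ a≢0 (c , (j₁ , cⱼ₁≢0) , cw≡0) = c⁺ , (punchIn i₀ j₁ , c⁺≢0) , c⁺v≡0
    where
    a S : ℤ
    a = v i₀ zero
    S = c · (λ j → v (punchIn i₀ j) zero)
    c⁺ : Vector ℤ (suc m)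
    c⁺ = insertAt (λ j → c j * a) i₀ (- S)

    c⁺≢0 : c⁺ (punchIn i₀ j₁) ≢ 0ℤ
    c⁺≢0 c⁺≡0 = a≢0 (i*j≡0∧i≢0⇒j≡0 (trans (sym (insertAt-punchIn _ i₀ (- S) j₁)) c⁺≡0) cⱼ₁≢0)

    c⁺v≡cw : ∀ t → c⁺ · (λ i → v i t) ≡ c · (λ j → eliminate v i₀ j t)
    c⁺v≡cw t = begin
      c⁺ · (λ i → v i t)
        ≡⟨ ·-insertAt _ i₀ (- S) (λ i → v i t) ⟩
      - S * v i₀ t + X
        ≡⟨ swap S (v i₀ t) X ⟩
      X + S * - v i₀ t
        ≡⟨ cong (_+_ X) (*-distribʳ-sum {m} (- v i₀ t) (λ j → c j * v (punchIn i₀ j) zero)) ⟩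
      X + sum (λ j → c j * v (punchIn i₀ j) zero * - v i₀ t)
        ≡⟨ ∑-distrib-+ (λ j → c j * a * v (punchIn i₀ j) t) _ ⟨
      sum (λ j → c j * a * v (punchIn i₀ j) t + c j * v (punchIn i₀ j) zero * - v i₀ t)
        ≡⟨ sum-cong-≗ (λ j → regroup (c j) a (v (punchIn i₀ j) t) (v (punchIn i₀ j) zero) (v i₀ t)) ⟩
      c · (λ j → eliminate v i₀ j t) ∎
      where
      X : ℤ
      X = sum (λ j → c j * a * v (punchIn i₀ j) t)
      swap : ∀ s x y → - s * x + y ≡ y + s * - x
      swap = solve-∀
      regroup : ∀ c a x y z → c * a * x + c * y * - z ≡ c * (a * x - y * z)
      regroup = solve-∀

    c⁺v≡0 : ∀ t → c⁺ · (λ i → v i t) ≡ 0ℤ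
    c⁺v≡0 zero    = trans (c⁺v≡cw zero) (trans (sum-cong-≗ eliminated) (sum-replicate-zero m))
      where
      cancel : ∀ x y → x * y - y * x ≡ 0ℤ
      cancel = solve-∀
      eliminated : ∀ j → c j * eliminate v i₀ j zero ≡ 0ℤ
      eliminated j = trans (cong (c j *_) (cancel a (v (punchIn i₀ j) zero))) (ℤ.*-zeroʳ (c j))
    c⁺v≡0 (suc t) = trans (c⁺v≡cw (suc t)) (cw≡0 t)

  <⇒dependent : d < m → (v : Fin m → Fin d → ℤ) → Dependent v
  <⇒dependent {zero}  {suc m} _ v = (λ _ → 1ℤ) , (zero , λ ()) , λ ()
  <⇒dependent {suc d} {suc m} (s≤s d<m) v with all? (λ i → v i zero ℤ.≟ 0ℤ)
  ... | yes v₀≡0 = dependent-tail v v₀≡0 (<⇒dependent (ℕ.m<n⇒m<1+n d<m) (λ i t → v i (suc t)))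
  ... | no ¬v₀≡0 with ¬∀⟶∃¬ _ _ (λ i → v i zero ℤ.≟ 0ℤ) ¬v₀≡0
  ...   | i₀ , vᵢ₀≢0 = dependent-eliminate v i₀ vᵢ₀≢0 (<⇒dependent d<m _)

  TrivialLeftKernel TrivialRightKernel : (Fin n → Fin n → ℤ) → Set
  TrivialLeftKernel  M = ∀ y → (∀ t → y · (λ p → M p t) ≡ 0ℤ) → ∀ p → y p ≡ 0ℤ
  TrivialRightKernel M = ∀ x → (∀ p → M p · x ≡ 0ℤ) → ∀ t → x t ≡ 0ℤ

  -- Among the n + 1 vectors e_t₀, M 0, …, M (n - 1) of ℤⁿ there is a relation; pairing it with x
  -- leaves only its e_t₀-coefficient times x t₀, and that coefficient is nonzero as M has no
  -- left kernel.
  trivialLeftKernel⇒trivialRightKernel : (M : Fin n → Fin n → ℤ) → TrivialLeftKernel M → TrivialRightKernel M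
  trivialLeftKernel⇒trivialRightKernel {n} M left x Mx≡0 t₀ = xₜ₀≡0 (<⇒dependent (ℕ.n<1+n n) v)
    where
    v : Fin (suc n) → Fin n → ℤ
    v zero    t = if ⌊ t ≟ t₀ ⌋ then 1ℤ else 0ℤ
    v (suc p) t = M p t

    xₜ₀≡0 : Dependent v → x t₀ ≡ 0ℤ
    xₜ₀≡0 (c , (i , cᵢ≢0) , cv≡0) = i*j≡0∧i≢0⇒j≡0 c₀xₜ₀≡0 c₀≢0
      where
      cM·x≡0 : (c ∘ suc) · (λ p → M p · x) ≡ 0ℤ
      cM·x≡0 = trans (sum-cong-≗ (λ p → trans (cong (c (suc p) *_) (Mx≡0 p)) (ℤ.*-zeroʳ (c (suc p)))))
                     (sum-replicate-zero n)

      c₀xₜ₀≡0 : c zero * x t₀ ≡ 0ℤ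
      c₀xₜ₀≡0 = begin
        c zero * x t₀                  ≡⟨ cong (c zero *_) (unit-· t₀ x) ⟨
        c zero * (v zero · x)          ≡⟨ ℤ.+-identityʳ (c zero * (v zero · x)) ⟨
        c zero * (v zero · x) + 0ℤ     ≡⟨ cong (_+_ (c zero * (v zero · x))) cM·x≡0 ⟨
        c · (λ i → v i · x)            ≡⟨ ·-assoc c v x ⟨
        (λ t → c · (λ i → v i t)) · x  ≡⟨ sum-cong-≗ (λ t → cong (_* x t) (cv≡0 t)) ⟩
        sum {n} (λ _ → 0ℤ)             ≡⟨ sum-replicate-zero n ⟩
        0ℤ                             ∎

      c₀≢0 : c zero ≢ 0ℤ
      c₀≢0 c₀≡0 = cᵢ≢0 (c≡0 i)
        where
        cM≡0 : ∀ t → (c ∘ suc) · (λ p → M p t) ≡ 0ℤ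
        cM≡0 t = trans (sym (trans (cong (λ c₀ → c₀ * v zero t + rest) c₀≡0) (ℤ.+-identityˡ rest))) (cv≡0 t)
          where
          rest : ℤ
          rest = (c ∘ suc) · (λ p → M p t)
        c≡0 : ∀ i → c i ≡ 0ℤ
        c≡0 zero    = c₀≡0
        c≡0 (suc p) = left (c ∘ suc) cM≡0 p

  sum-J+kI : ∀ k (c v : Vector ℤ n) p → c p ≡ 1ℤ + k → (∀ q → q ≢ p → c q ≡ 1ℤ) →
             c · v ≡ sum v + k * v p
  sum-J+kI {n} k c v p cₚ≡1+k c≡1 = begin
    sum (λ q → c q * v q)                 ≡⟨ sum-cong-≗ (λ q → split (c q) (v q)) ⟩
    sum (λ q → v q + (c q - 1ℤ) * v q)    ≡⟨ ∑-distrib-+ v (λ q → (c q - 1ℤ) * v q) ⟩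
    sum v + sum (λ q → (c q - 1ℤ) * v q)  ≡⟨ cong (_+_ (sum v)) (sum-single ℤ.+-0-commutativeMonoid _ p off) ⟩
    sum v + (c p - 1ℤ) * v p              ≡⟨ cong (λ x → sum v + (x - 1ℤ) * v p) cₚ≡1+k ⟩
    sum v + (1ℤ + k - 1ℤ) * v p           ≡⟨ cong (_+_ (sum v)) (cancel k (v p)) ⟩
    sum v + k * v p                       ∎
    where
    split : ∀ a b → a * b ≡ b + (a - 1ℤ) * b
    split = solve-∀
    cancel : ∀ a b → (1ℤ + a - 1ℤ) * b ≡ a * b
    cancel = solve-∀
    off : ∀ q → q ≢ p → (c q - 1ℤ) * v q ≡ 0ℤ
    off q q≢p rewrite c≡1 q q≢p = ℤ.*-zeroˡ (v q)

  J+kI-trivialLeftKernel : ∀ k → k ≢ 0ℤ → + n + k ≢ 0ℤ → (y : Vector ℤ n) →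
                           (∀ q → sum y + k * y q ≡ 0ℤ) → ∀ q → y q ≡ 0ℤ
  J+kI-trivialLeftKernel {n} k k≢0 n+k≢0 y yC≡0 q =
    i*j≡0∧i≢0⇒j≡0 (trans (sym (ℤ.+-identityˡ (k * y q))) (trans (cong (_+ k * y q) (sym ∑y≡0)) (yC≡0 q))) k≢0
    where
    ∑y≡0 : sum y ≡ 0ℤ
    ∑y≡0 = i*j≡0∧i≢0⇒j≡0 (begin
      (+ n + k) * sum y                            ≡⟨ ℤ.*-distribʳ-+ (sum y) (+ n) k ⟩
      + n * sum y + k * sum y                      ≡⟨ cong₂ _+_ (sym (sum-const n (sum y))) (*-distribˡ-sum k y) ⟩
      sum {n} (λ _ → sum y) + sum (λ q → k * y q)  ≡⟨ ∑-distrib-+ (λ _ → sum y) (λ q → k * y q) ⟨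
      sum (λ q → sum y + k * y q)                  ≡⟨ sum-cong-≗ yC≡0 ⟩
      sum {n} (λ _ → 0ℤ)                           ≡⟨ sum-replicate-zero n ⟩
      0ℤ                                           ∎) n+k≢0

  +∑ : ∀ n (f : Fin n → ℕ) → + ∑ n f ≡ sum (+_ ∘ f)
  +∑ zero    f = refl
  +∑ (suc n) f = trans (ℤ.pos-+ (f zero) _) (cong (λ s → + f zero + s) (+∑ n (f ∘ suc)))

  ⟦_⟧ : Mat n → Fin n → Fin n → ℤ
  ⟦ A ⟧ p q = + A p q

  ⟦∑⟧ : ∀ {n r} (f : Fin n → ℕ) → ∑ n f ≡ r → sum (λ t → + f t) ≡ + r
  ⟦∑⟧ {n} f ∑f≡r = trans (sym (+∑ n f)) (cong +_ ∑f≡r)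

  ⟦ABt⟧ : ∀ (A B : Mat n) p q → + ABt A B p q ≡ ⟦ A ⟧ p · ⟦ B ⟧ q
  ⟦ABt⟧ {n} A B p q = trans (+∑ n _) (sum-cong-≗ (λ t → ℤ.pos-* (A p t) (B q t)))

  module JplusKI-Properties {n k} {A B : Mat n} (AB≡J+kI : IsJplusKI n k A B) where

    private
      diag : ∀ p → + ABt A B p p ≡ 1ℤ + k
      diag = proj₁ AB≡J+kI
      off : ∀ p q → p ≢ q → ABt A B p q ≡ 1
      off = proj₂ AB≡J+kI

    J+kI-row : ∀ p (v : Vector ℤ n) → (λ q → ⟦ A ⟧ p · ⟦ B ⟧ q) · v ≡ sum v + k * v p
    J+kI-row p v = sum-J+kI k _ v p (trans (sym (⟦ABt⟧ A B p p)) (diag p))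
                                   (λ q q≢p → trans (sym (⟦ABt⟧ A B p q)) (cong +_ (off p q (≢-sym q≢p))))

    J+kI-col : ∀ q (v : Vector ℤ n) → (λ p → ⟦ A ⟧ p · ⟦ B ⟧ q) · v ≡ sum v + k * v q
    J+kI-col q v = sum-J+kI k _ v q (trans (sym (⟦ABt⟧ A B q q)) (diag q))
                                   (λ p p≢q → trans (sym (⟦ABt⟧ A B p q)) (cong +_ (off p q p≢q)))

    J+kI⇒trivialLeftKernel : k ≢ 0ℤ → + n + k ≢ 0ℤ → TrivialLeftKernel ⟦ A ⟧
    J+kI⇒trivialLeftKernel k≢0 n+k≢0 y yA≡0 = J+kI-trivialLeftKernel k k≢0 n+k≢0 y (λ q → begin
      sum y + k * y q                            ≡⟨ J+kI-col q y ⟨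
      (λ p → ⟦ A ⟧ p · ⟦ B ⟧ q) · y              ≡⟨ ·-comm _ y ⟩
      y · (λ p → ⟦ A ⟧ p · ⟦ B ⟧ q)              ≡⟨ ·-assoc y ⟦ A ⟧ (⟦ B ⟧ q) ⟨
      (λ t → y · (λ p → ⟦ A ⟧ p t)) · ⟦ B ⟧ q    ≡⟨ sum-cong-≗ (λ t → cong (_* + B q t) (yA≡0 t)) ⟩
      sum {n} (λ _ → 0ℤ)                         ≡⟨ sum-replicate-zero n ⟩
      0ℤ                                         ∎)

  -- A (BᵀA) = (J + kI) A = r J + k A = A (J + kI), and A is injective.
  transpose-J+kI : ∀ {n r k} {A B : Mat n} → IsRegular n r A → IsJplusKI n k A B →
                   k ≢ 0ℤ → + n + k ≢ 0ℤ → IsJplusKI n k (flip B) (flip A)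
  transpose-J+kI {n} {r} {k} {A} {B} (rowA , colA) AB≡J+kI k≢0 n+k≢0 = diagᵀ , offᵀ
    where
    open JplusKI-Properties {k = k} {A} {B} AB≡J+kI

    BᵀA E : Fin n → Fin n → ℤ
    BᵀA j w = (λ i → + B i j) · (λ i → + A i w)
    E j w = if ⌊ j ≟ w ⌋ then 1ℤ + k else 1ℤ

    A·BᵀA : ∀ p w → ⟦ A ⟧ p · (λ j → BᵀA j w) ≡ + r + k * + A p w
    A·BᵀA p w = begin
      ⟦ A ⟧ p · (λ j → BᵀA j w)                    ≡⟨ ·-assoc (⟦ A ⟧ p) (λ j i → + B i j) (λ i → + A i w) ⟨
      (λ i → ⟦ A ⟧ p · ⟦ B ⟧ i) · (λ i → + A i w)  ≡⟨ J+kI-row p (λ i → + A i w) ⟩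
      sum (λ i → + A i w) + k * + A p w            ≡⟨ cong (_+ k * + A p w) (⟦∑⟧ (λ i → A i w) (colA w)) ⟩
      + r + k * + A p w                            ∎

    A·E : ∀ p w → ⟦ A ⟧ p · (λ j → E j w) ≡ + r + k * + A p w
    A·E p w = begin
      ⟦ A ⟧ p · (λ j → E j w)      ≡⟨ ·-comm (⟦ A ⟧ p) _ ⟩
      (λ j → E j w) · ⟦ A ⟧ p      ≡⟨ sum-J+kI k _ (⟦ A ⟧ p) w (if-≟-refl _ _ w) (λ j → if-≟-≢ _ _) ⟩
      sum (⟦ A ⟧ p) + k * + A p w  ≡⟨ cong (_+ k * + A p w) (⟦∑⟧ (A p) (rowA p)) ⟩
      + r + k * + A p w            ∎

    BᵀA≡E : ∀ j w → BᵀA j w ≡ E j w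
    BᵀA≡E j w = ℤ.i-j≡0⇒i≡j _ _ (trivialLeftKernel⇒trivialRightKernel ⟦ A ⟧
                  (J+kI⇒trivialLeftKernel k≢0 n+k≢0) (λ j → BᵀA j w - E j w) A[BᵀA-E]≡0 j)
      where
      A[BᵀA-E]≡0 : ∀ p → ⟦ A ⟧ p · (λ j → BᵀA j w - E j w) ≡ 0ℤ
      A[BᵀA-E]≡0 p = trans (·-distrib-− (⟦ A ⟧ p) _ _)
                           (trans (cong₂ _-_ (A·BᵀA p w) (A·E p w)) (ℤ.+-inverseʳ (+ r + k * + A p w)))

    diagᵀ : ∀ j → + ABt (flip B) (flip A) j j ≡ 1ℤ + k
    diagᵀ j = trans (⟦ABt⟧ (flip B) (flip A) j j) (trans (BᵀA≡E j j) (if-≟-refl _ _ j))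

    offᵀ : ∀ j w → j ≢ w → ABt (flip B) (flip A) j w ≡ 1
    offᵀ j w j≢w = ℤ.+-injective (trans (⟦ABt⟧ (flip B) (flip A) j w) (trans (BᵀA≡E j w) (if-≟-≢ _ _ j≢w)))

open IntegerMatrices using (transpose-J+kI)
open import Data.Nat.Base using (_+_; _*_; _∸_; _≤_; _<_; z≤n; s≤s)
import Data.Nat.Properties as ℕ
open import Data.Nat.Tactic.RingSolver using (solve-∀)
open import Algebra.Properties.Semiring.Sum ℕ.+-*-semiring as ℕΣ using (sum)

∑≗sum : ∀ n (f : Fin n → ℕ) → ∑ n f ≡ sum f
∑≗sum zero    f = refl
∑≗sum (suc n) f = cong (f zero +_) (∑≗sum n (f ∘ suc))

∑-cong : ∀ n {f g : Fin n → ℕ} → (∀ i → f i ≡ g i) → ∑ n f ≡ ∑ n g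
∑-cong zero    f≗g = refl
∑-cong (suc n) f≗g = cong₂ _+_ (f≗g zero) (∑-cong n (f≗g ∘ suc))

∑-zero : ∀ n {f : Fin n → ℕ} → (∀ i → f i ≡ 0) → ∑ n f ≡ 0
∑-zero zero    f≗0 = refl
∑-zero (suc n) f≗0 = cong₂ _+_ (f≗0 zero) (∑-zero n (f≗0 ∘ suc))

∑≡0⇒≡0 : ∀ n {f : Fin n → ℕ} → ∑ n f ≡ 0 → ∀ i → f i ≡ 0
∑≡0⇒≡0 (suc n) {f} ∑f≡0 zero    = ℕ.m+n≡0⇒m≡0 (f zero) ∑f≡0
∑≡0⇒≡0 (suc n) {f} ∑f≡0 (suc i) = ∑≡0⇒≡0 n (ℕ.m+n≡0⇒n≡0 (f zero) ∑f≡0) i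

∑-remove : ∀ n (h : Fin (suc n) → ℕ) i → ∑ (suc n) h ≡ h i + ∑ n (h ∘ punchIn i)
∑-remove n h i = trans (∑≗sum (suc n) h)
  (trans (ℕΣ.sum-remove {i = i} h) (cong (h i +_) (sym (∑≗sum n (h ∘ punchIn i)))))

∑-distrib-+ : ∀ n (f g : Fin n → ℕ) → ∑ n (λ i → f i + g i) ≡ ∑ n f + ∑ n g
∑-distrib-+ n f g = trans (∑≗sum n _)
  (trans (ℕΣ.∑-distrib-+ f g) (sym (cong₂ _+_ (∑≗sum n f) (∑≗sum n g))))

∑-*ˡ : ∀ n c (f : Fin n → ℕ) → ∑ n (λ i → c * f i) ≡ c * ∑ n f
∑-*ˡ n c f = trans (∑≗sum n _) (trans (sym (ℕΣ.*-distribˡ-sum c f)) (cong (c *_) (sym (∑≗sum n f))))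

∑-single : ∀ n (f : Fin n → ℕ) i → (∀ j → j ≢ i → f j ≡ 0) → ∑ n f ≡ f i
∑-single n f i f≡0 = trans (∑≗sum n f) (sum-single ℕ.+-0-commutativeMonoid f i f≡0)

∑-≥ : ∀ n (h : Fin n → ℕ) i → h i ≤ ∑ n h
∑-≥ (suc n) h i = subst (h i ≤_) (sym (∑-remove n h i)) (ℕ.m≤m+n (h i) _)

∑-≥-pair : ∀ n (h : Fin n → ℕ) {a b} → a ≢ b → h a + h b ≤ ∑ n h
∑-≥-pair (suc n) h {a} {b} a≢b = subst (h a + h b ≤_) (sym (∑-remove n h a))
  (ℕ.+-monoʳ-≤ (h a) (subst (λ t → h t ≤ _) (punchIn-punchOut a≢b) (∑-≥ n (h ∘ punchIn a) (punchOut a≢b))))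

δ : ∀ {n} → Fin n → Fin n → ℕ
δ p q = if ⌊ p ≟ q ⌋ then 1 else 0

∑-δ : ∀ n x (h : Fin n → ℕ) → ∑ n (λ p → δ p x * h p) ≡ h x
∑-δ n x h = trans (∑-single n _ x (λ p p≢x → cong (_* h p) (if-≟-≢ 1 0 p≢x)))
                  (trans (cong (_* h x) (if-≟-refl 1 0 x)) (ℕ.*-identityˡ (h x)))

vanishing-δ : ∀ {n} {u : Fin n → ℕ} {a b c} → (∀ l → NotIn3 l a b c → u l ≡ 0) → u c ≡ 1 →
              ∀ l → l ≢ a → l ≢ b → u l ≡ δ l c
vanishing-δ {c = c} u≡0 uc≡1 l l≢a l≢b with l ≟ c
... | yes refl = uc≡1
... | no l≢c   = u≡0 l (l≢a , l≢b , l≢c)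

m+m≤1⇒m≡0 : ∀ m → m + m ≤ 1 → m ≡ 0
m+m≤1⇒m≡0 zero    _             = refl
m+m≤1⇒m≡0 (suc m) (s≤s m+1+m≤0) = contradiction (subst (_≤ 0) (ℕ.+-suc m m) m+1+m≤0) λ ()

if-1-else : ∀ b {a} → (T b → a ≡ 0) → (if b then 1 else a) ≡ a + (if b then 1 else 0)
if-1-else true      a≡0 = cong (_+ 1) (sym (a≡0 _))
if-1-else false {a} _   = sym (ℕ.+-identityʳ a)

if-∨ : ∀ b c → ¬ (T b × T c) → (if b ∨ c then 1 else 0) ≡ (if b then 1 else 0) + (if c then 1 else 0)
if-∨ true  true  ¬both = contradiction _ ¬both
if-∨ true  false _     = refl
if-∨ false c     _     = refl

if-∧ : ∀ b c → (if b ∧ c then 1 else 0) ≡ (if b then 1 else 0) * (if c then 1 else 0)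
if-∧ true  true  = refl
if-∧ true  false = refl
if-∧ false c     = refl

Fin1-unique : (i j : Fin 1) → i ≡ j
Fin1-unique zero zero = refl

distinct⇒≡3+ : ∀ {n} {x y z : Fin n} → Distinct3 x y z → ∃ λ m → n ≡ 3 + m
distinct⇒≡3+ {suc zero}          (x≢y , _)         = contradiction (Fin1-unique _ _) x≢y
distinct⇒≡3+ {suc (suc zero)}    (x≢y , x≢z , y≢z) = contradiction (punchOut-injective x≢y x≢z (Fin1-unique _ _)) y≢z
distinct⇒≡3+ {suc (suc (suc m))} _                 = m , refl

module Complement {m : ℕ} {x y z : Fin (3 + m)} (distinct : Distinct3 x y z) where

  private
    x≢y : x ≢ y
    x≢y = proj₁ distinct
    x≢z : x ≢ z
    x≢z = proj₁ (proj₂ distinct)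
    y≢z : y ≢ z
    y≢z = proj₂ (proj₂ distinct)
    y₁ z₁ : Fin (2 + m)
    y₁ = punchOut x≢y
    z₁ = punchOut x≢z
    y₁≢z₁ : y₁ ≢ z₁
    y₁≢z₁ = y≢z ∘ punchOut-injective x≢y x≢z
    z₂ : Fin (1 + m)
    z₂ = punchOut y₁≢z₁
    ↑y₁≡y : punchIn x y₁ ≡ y
    ↑y₁≡y = punchIn-punchOut x≢y
    ↑↑z₂≡z : punchIn x (punchIn y₁ z₂) ≡ z
    ↑↑z₂≡z = trans (cong (punchIn x) (punchIn-punchOut y₁≢z₁)) (punchIn-punchOut x≢z)

  others : Fin m → Fin (3 + m)
  others = punchIn x ∘ punchIn y₁ ∘ punchIn z₂

  others-injective : ∀ i j → others i ≡ others j → i ≡ j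
  others-injective i j = punchIn-injective z₂ i j ∘ punchIn-injective y₁ _ _ ∘ punchIn-injective x _ _

  others-∉ : ∀ i → NotIn3 (others i) x y z
  others-∉ i = punchInᵢ≢i x _
             , punchInᵢ≢i y₁ _ ∘ punchIn-injective x _ _ ∘ (λ eq → trans eq (sym ↑y₁≡y))
             , punchInᵢ≢i z₂ i ∘ punchIn-injective y₁ _ _ ∘ punchIn-injective x _ _ ∘ (λ eq → trans eq (sym ↑↑z₂≡z))

  others-surjective : ∀ v → NotIn3 v x y z → ∃ λ i → others i ≡ v
  others-surjective v (v≢x , v≢y , v≢z) = punchOut z₂≢v₂ , others-v₃≡v
    where
    x≢v : x ≢ v
    x≢v = v≢x ∘ sym
    v₁ : Fin (2 + m)
    v₁ = punchOut x≢v
    y₁≢v₁ : y₁ ≢ v₁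
    y₁≢v₁ = v≢y ∘ sym ∘ punchOut-injective x≢y x≢v
    v₂ : Fin (1 + m)
    v₂ = punchOut y₁≢v₁
    z₂≢v₂ : z₂ ≢ v₂
    z₂≢v₂ = v≢z ∘ sym ∘ punchOut-injective x≢z x≢v ∘ punchOut-injective y₁≢z₁ y₁≢v₁
    others-v₃≡v : others (punchOut z₂≢v₂) ≡ v
    others-v₃≡v = trans (cong (punchIn x ∘ punchIn y₁) (punchIn-punchOut z₂≢v₂))
                        (trans (cong (punchIn x) (punchIn-punchOut y₁≢v₁)) (punchIn-punchOut x≢v))

  others-enumerate : EnumeratesComplement others x y z
  others-enumerate = others-injective , (λ { v (i , refl) → others-∉ i }) , others-surjective

  ∑-split : ∀ (h : Fin (3 + m) → ℕ) → ∑ (3 + m) h ≡ (h x + (h y + h z)) + ∑ m (h ∘ others)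
  ∑-split h = begin
    ∑ (3 + m) h
      ≡⟨ ∑-remove _ h x ⟩
    h x + ∑ (2 + m) (h ∘ punchIn x)
      ≡⟨ cong (h x +_) (∑-remove _ (h ∘ punchIn x) y₁) ⟩
    h x + (h (punchIn x y₁) + ∑ (1 + m) (h ∘ punchIn x ∘ punchIn y₁))
      ≡⟨ cong (λ r → h x + (h (punchIn x y₁) + r)) (∑-remove _ (h ∘ punchIn x ∘ punchIn y₁) z₂) ⟩
    h x + (h (punchIn x y₁) + (h (punchIn x (punchIn y₁ z₂)) + ∑ m (h ∘ others)))
      ≡⟨ cong₂ (λ u v → h x + (h u + (h v + ∑ m (h ∘ others)))) ↑y₁≡y ↑↑z₂≡z ⟩
    h x + (h y + (h z + ∑ m (h ∘ others)))
      ≡⟨ reassociate (h x) (h y) (h z) _ ⟩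
    (h x + (h y + h z)) + ∑ m (h ∘ others) ∎
    where
    open ≡-Reasoning
    reassociate : ∀ a b c r → a + (b + (c + r)) ≡ (a + (b + c)) + r
    reassociate = solve-∀

  ∑-others-∸ : ∀ (h : Fin (3 + m) → ℕ) {c} → ∑ (3 + m) h ≡ c → ∑ m (h ∘ others) ≡ c ∸ (h x + (h y + h z))
  ∑-others-∸ h ∑h≡c = sym (trans (cong (_∸ (h x + (h y + h z))) (trans (sym ∑h≡c) (∑-split h)))
                                 (ℕ.m+n∸m≡n (h x + (h y + h z)) _))

  ∑-others : ∀ (h : Fin (3 + m) → ℕ) {c} → ∑ (3 + m) h ≡ c + (h x + (h y + h z)) → ∑ m (h ∘ others) ≡ c
  ∑-others h {c} ∑h≡ = trans (∑-others-∸ h ∑h≡) (ℕ.m+n∸n≡m c (h x + (h y + h z)))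

  ∑≡⇒zero-outside : ∀ (u : Fin (3 + m) → ℕ) → ∑ (3 + m) u ≡ u x + (u y + u z) →
                    ∀ l → NotIn3 l x y z → u l ≡ 0
  ∑≡⇒zero-outside u ∑u≡ l l∉ with others-surjective l l∉
  ... | i , refl = ∑≡0⇒≡0 m (∑-others u ∑u≡) i

  ones⇒zero-outside : ∀ (u : Fin (3 + m) → ℕ) → ∑ (3 + m) u ≡ 3 → u x ≡ 1 → u y ≡ 1 → u z ≡ 1 →
                      ∀ l → NotIn3 l x y z → u l ≡ 0
  ones⇒zero-outside u ∑u≡3 ux≡1 uy≡1 uz≡1 =
    ∑≡⇒zero-outside u (trans ∑u≡3 (sym (cong₂ _+_ ux≡1 (cong₂ _+_ uy≡1 uz≡1))))

  ∑-*-indicator : ∀ (u v : Fin (3 + m) → ℕ) → u x ≡ 1 → u y ≡ 1 → u z ≡ 1 →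
                  (∀ l → NotIn3 l x y z → u l ≡ 0) → ∑ (3 + m) (λ l → u l * v l) ≡ v x + (v y + v z)
  ∑-*-indicator u v ux≡1 uy≡1 uz≡1 u≡0 = begin
    ∑ (3 + m) (λ l → u l * v l)                 ≡⟨ ∑-split (λ l → u l * v l) ⟩
    (u x * v x + (u y * v y + u z * v z)) + ∑ m (λ i → u (others i) * v (others i))
      ≡⟨ cong₂ _+_ (cong₂ _+_ (pick ux≡1) (cong₂ _+_ (pick uy≡1) (pick uz≡1)))
                   (∑-zero m (λ i → cong (_* v (others i)) (u≡0 (others i) (others-∉ i)))) ⟩
    (v x + (v y + v z)) + 0                     ≡⟨ ℕ.+-identityʳ _ ⟩
    v x + (v y + v z)                           ∎
    where
    open ≡-Reasoning
    pick : ∀ {t} → u t ≡ 1 → u t * v t ≡ v t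
    pick {t} ut≡1 = trans (cong (_* v t) ut≡1) (ℕ.*-identityˡ (v t))

-- D is the diagonal 1 + k of ABᵀ, and s-large is the hypothesis s > 2 (k = 1), s > 1 (k = -1).
module LadderReduction
  {m s D : ℕ} {A B : Mat (3 + m)}
  (A-zeroOne : IsZeroOne A) (A-regular : IsRegular (3 + m) 3 A) (B-regular : IsRegular (3 + m) s B)
  (ABᵀ-diag : ∀ p → ABt A B p p ≡ D) (ABᵀ-off : ∀ p q → p ≢ q → ABt A B p q ≡ 1)
  (BᵀA-off : ∀ j w → j ≢ w → ABt (flip B) (flip A) j w ≡ 1)
  (s-large : 2 + D < s + s)
  {b0 b1 b2 w0 w1 w2 wL bL wR bR : Fin (3 + m)}
  (distinctB : Distinct3 b0 b1 b2) (distinctW : Distinct3 w0 w1 w2)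
  (b0w0 : A b0 w0 ≡ 1) (b1w1 : A b1 w1 ≡ 1) (b2w2 : A b2 w2 ≡ 1)
  (b0w1 : A b0 w1 ≡ 1) (b2w1 : A b2 w1 ≡ 1) (b1w0 : A b1 w0 ≡ 1) (b1w2 : A b1 w2 ≡ 1)
  (b0wL : A b0 wL ≡ 1) (wL∉ : NotIn3 wL w0 w1 w2)
  (bLw0 : A bL w0 ≡ 1) (bL∉ : NotIn3 bL b0 b1 b2)
  (b2wR : A b2 wR ≡ 1) (wR∉ : NotIn3 wR w0 w1 w2)
  (bRw2 : A bR w2 ≡ 1) (bR∉ : NotIn3 bR b0 b1 b2)
  where

  private
    open ≡-Reasoning

    n : ℕ
    n = 3 + m

    rowA : ∀ p → ∑ n (A p) ≡ 3
    rowA = proj₁ A-regular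
    colA : ∀ l → ∑ n (λ p → A p l) ≡ 3
    colA = proj₂ A-regular
    colB : ∀ l → ∑ n (λ q → B q l) ≡ s
    colB = proj₂ B-regular

  module Bs = Complement distinctB
  module Ws = Complement distinctW

  private
    module W01L = Complement (proj₁ distinctW , ≢-sym (proj₁ wL∉) , ≢-sym (proj₁ (proj₂ wL∉)))
    module W12R = Complement (proj₂ (proj₂ distinctW) , ≢-sym (proj₁ (proj₂ wR∉)) , ≢-sym (proj₂ (proj₂ wR∉)))
    module B01L = Complement (proj₁ distinctB , ≢-sym (proj₁ bL∉) , ≢-sym (proj₁ (proj₂ bL∉)))
    module B12R = Complement (proj₂ (proj₂ distinctB) , ≢-sym (proj₁ (proj₂ bR∉)) , ≢-sym (proj₂ (proj₂ bR∉)))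

    col-w0 : ∀ p → NotIn3 p b0 b1 bL → A p w0 ≡ 0
    col-w0 = B01L.ones⇒zero-outside (λ p → A p w0) (colA w0) b0w0 b1w0 bLw0
    col-w1 : ∀ p → NotIn3 p b0 b1 b2 → A p w1 ≡ 0
    col-w1 = Bs.ones⇒zero-outside (λ p → A p w1) (colA w1) b0w1 b1w1 b2w1
    col-w2 : ∀ p → NotIn3 p b1 b2 bR → A p w2 ≡ 0
    col-w2 = B12R.ones⇒zero-outside (λ p → A p w2) (colA w2) b1w2 b2w2 bRw2
    row-b0 : ∀ l → NotIn3 l w0 w1 wL → A b0 l ≡ 0
    row-b0 = W01L.ones⇒zero-outside (A b0) (rowA b0) b0w0 b0w1 b0wL
    row-b1 : ∀ l → NotIn3 l w0 w1 w2 → A b1 l ≡ 0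
    row-b1 = Ws.ones⇒zero-outside (A b1) (rowA b1) b1w0 b1w1 b1w2
    row-b2 : ∀ l → NotIn3 l w1 w2 wR → A b2 l ≡ 0
    row-b2 = W12R.ones⇒zero-outside (A b2) (rowA b2) b2w1 b2w2 b2wR

  B-ladder-row : ∀ q → NotIn3 q b0 b1 b2 → B q w0 + (B q w1 + B q w2) ≡ 1
  B-ladder-row q q∉ = trans (sym (Ws.∑-*-indicator (A b1) (B q) b1w0 b1w1 b1w2 row-b1))
                            (ABᵀ-off b1 q (≢-sym (proj₁ (proj₂ q∉))))

  B-wL≡B-w2 : ∀ q → NotIn3 q b0 b1 b2 → B q wL ≡ B q w2
  B-wL≡B-w2 q q∉ = ℕ.+-cancelˡ-≡ (B q w1) _ _ (ℕ.+-cancelˡ-≡ (B q w0) _ _ (begin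
    B q w0 + (B q w1 + B q wL)  ≡⟨ W01L.∑-*-indicator (A b0) (B q) b0w0 b0w1 b0wL row-b0 ⟨
    ABt A B b0 q                ≡⟨ ABᵀ-off b0 q (≢-sym (proj₁ q∉)) ⟩
    1                           ≡⟨ B-ladder-row q q∉ ⟨
    B q w0 + (B q w1 + B q w2)  ∎))

  B-wR≡B-w0 : ∀ q → NotIn3 q b0 b1 b2 → B q wR ≡ B q w0
  B-wR≡B-w0 q q∉ = ℕ.+-cancelˡ-≡ (B q w2) _ _ (ℕ.+-cancelˡ-≡ (B q w1) _ _ (begin
    B q w1 + (B q w2 + B q wR)  ≡⟨ W12R.∑-*-indicator (A b2) (B q) b2w1 b2w2 b2wR row-b2 ⟨
    ABt A B b2 q                ≡⟨ ABᵀ-off b2 q (≢-sym (proj₂ (proj₂ q∉))) ⟩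
    1                           ≡⟨ B-ladder-row q q∉ ⟨
    B q w0 + (B q w1 + B q w2)  ≡⟨ rotate (B q w0) (B q w1) (B q w2) ⟩
    B q w1 + (B q w2 + B q w0)  ∎))
    where
    rotate : ∀ a b c → a + (b + c) ≡ b + (c + a)
    rotate = solve-∀

  B-ladder-col : ∀ l → NotIn3 l w0 w1 w2 → B b0 l + (B b1 l + B b2 l) ≡ 1
  B-ladder-col l l∉ = begin
    B b0 l + (B b1 l + B b2 l)              ≡⟨ Bs.∑-*-indicator (λ p → A p w1) (λ p → B p l) b0w1 b1w1 b2w1 col-w1 ⟨
    ∑ n (λ p → A p w1 * B p l)              ≡⟨ ∑-cong n (λ p → ℕ.*-comm (A p w1) (B p l)) ⟩
    ABt (flip B) (flip A) l w1              ≡⟨ BᵀA-off l w1 (proj₁ (proj₂ l∉)) ⟩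
    1                                       ∎

  -- Every black q ∉ L other than x has B q wX + B q wX ≤ (ABᵀ) x q = 1, so the column of wX
  -- in B sums to s = 1 + B x wX, while B x wX + B x wX ≤ (ABᵀ) x x = D.
  ¬twins : ∀ {x wX a b} → NotIn3 x b0 b1 b2 → NotIn3 wX w0 w1 w2 → a ≢ b → A x a ≡ 1 → A x b ≡ 1 →
           (∀ q → NotIn3 q b0 b1 b2 → B q a ≡ B q wX) → (∀ q → NotIn3 q b0 b1 b2 → B q b ≡ B q wX) → ⊥
  ¬twins {x} {wX} {a} {b} x∉ wX∉ a≢b xa≡1 xb≡1 Ba≡ Bb≡ = ℕ.<⇒≱ s-large s+s≤2+D
    where
    twice≤ : ∀ q → NotIn3 q b0 b1 b2 → B q wX + B q wX ≤ ABt A B x q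
    twice≤ q q∉ = subst (_≤ ABt A B x q) (cong₂ _+_ (edge xa≡1 (Ba≡ q q∉)) (edge xb≡1 (Bb≡ q q∉)))
                        (∑-≥-pair n (λ l → A x l * B q l) a≢b)
      where
      edge : ∀ {t} → A x t ≡ 1 → B q t ≡ B q wX → A x t * B q t ≡ B q wX
      edge {t} xt≡1 Bt≡ = trans (cong (_* B q t) xt≡1) (trans (ℕ.*-identityˡ (B q t)) Bt≡)

    zero-off-x : ∀ q → NotIn3 q b0 b1 b2 → q ≢ x → B q wX ≡ 0
    zero-off-x q q∉ q≢x = m+m≤1⇒m≡0 (B q wX) (subst (B q wX + B q wX ≤_) (ABᵀ-off x q (≢-sym q≢x)) (twice≤ q q∉))

    s≡1+BxwX : s ≡ 1 + B x wX
    s≡1+BxwX with Bs.others-surjective x x∉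
    ... | i , refl = begin
      s                                                  ≡⟨ colB wX ⟨
      ∑ n (λ q → B q wX)                                 ≡⟨ Bs.∑-split (λ q → B q wX) ⟩
      (B b0 wX + (B b1 wX + B b2 wX)) + ∑ m (λ j → B (Bs.others j) wX)
        ≡⟨ cong₂ _+_ (B-ladder-col wX wX∉) (∑-single m _ i (λ j j≢i →
             zero-off-x (Bs.others j) (Bs.others-∉ j) (j≢i ∘ Bs.others-injective j i))) ⟩
      1 + B (Bs.others i) wX                             ∎

    s+s≤2+D : s + s ≤ 2 + D
    s+s≤2+D = subst (_≤ 2 + D) (sym (trans (cong₂ _+_ s≡1+BxwX s≡1+BxwX) (regroup (B x wX))))
                    (ℕ.+-monoʳ-≤ 2 (subst (B x wX + B x wX ≤_) (ABᵀ-diag x) (twice≤ x x∉)))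
      where
      regroup : ∀ t → (1 + t) + (1 + t) ≡ 2 + (t + t)
      regroup = solve-∀

  bL-wR-nonedge : A bL wR ≡ 0
  bL-wR-nonedge with A-zeroOne bL wR
  ... | inj₁ bLwR≡0 = bLwR≡0
  ... | inj₂ bLwR≡1 = ⊥-elim (¬twins bL∉ wR∉ (≢-sym (proj₁ wR∉)) bLw0 bLwR≡1
                                      (λ q q∉ → sym (B-wR≡B-w0 q q∉)) (λ _ _ → refl))

  bR-wL-nonedge : A bR wL ≡ 0
  bR-wL-nonedge with A-zeroOne bR wL
  ... | inj₁ bRwL≡0 = bRwL≡0
  ... | inj₂ bRwL≡1 = ⊥-elim (¬twins bR∉ wL∉ (≢-sym (proj₂ (proj₂ wL∉))) bRw2 bRwL≡1
                                      (λ q q∉ → sym (B-wL≡B-w2 q q∉)) (λ _ _ → refl))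

  new-edges-distinct : bL ≡ bR → wL ≡ wR → ⊥
  new-edges-distinct refl refl =
    ¬twins bL∉ wR∉ (proj₁ (proj₂ distinctW)) bLw0 bRw2 (λ q q∉ → sym (B-wR≡B-w0 q q∉)) (λ q q∉ → sym (B-wL≡B-w2 q q∉))

  E : Fin n → Fin n → ℕ
  E p l = δ p bL * δ l wR + δ p bR * δ l wL

  A⁺ : Fin n → Fin n → ℕ
  A⁺ p l = A p l + E p l

  reduce-entry : ∀ p l → (if (⌊ p ≟ bL ⌋ ∧ ⌊ l ≟ wR ⌋) ∨ (⌊ p ≟ bR ⌋ ∧ ⌊ l ≟ wL ⌋) then 1 else A p l) ≡ A⁺ p l
  reduce-entry p l = begin
    (if newL ∨ newR then 1 else A p l)      ≡⟨ if-1-else (newL ∨ newR) nonedge ⟩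
    A p l + (if newL ∨ newR then 1 else 0)  ≡⟨ cong (A p l +_) (trans (if-∨ newL newR disjoint)
                                                   (cong₂ _+_ (if-∧ ⌊ p ≟ bL ⌋ ⌊ l ≟ wR ⌋) (if-∧ ⌊ p ≟ bR ⌋ ⌊ l ≟ wL ⌋))) ⟩
    A⁺ p l                                  ∎
    where
    newL newR : Bool
    newL = ⌊ p ≟ bL ⌋ ∧ ⌊ l ≟ wR ⌋
    newR = ⌊ p ≟ bR ⌋ ∧ ⌊ l ≟ wL ⌋
    endpoints : ∀ {x y} → T (⌊ p ≟ x ⌋ ∧ ⌊ l ≟ y ⌋) → p ≡ x × l ≡ y
    endpoints {x} {y} t = Product.map (toWitness {a? = p ≟ x}) (toWitness {a? = l ≟ y}) (Equivalence.to T-∧ t)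
    nonedge : T (newL ∨ newR) → A p l ≡ 0
    nonedge t with Equivalence.to T-∨ t
    ... | inj₁ tL with refl , refl ← endpoints tL = bL-wR-nonedge
    ... | inj₂ tR with refl , refl ← endpoints tR = bR-wL-nonedge
    disjoint : ¬ (T newL × T newR)
    disjoint (tL , tR) with p≡bL , l≡wR ← endpoints tL | p≡bR , l≡wL ← endpoints tR =
      new-edges-distinct (trans (sym p≡bL) p≡bR) (trans (sym l≡wL) l≡wR)

  private
    A⁺≡A-col : ∀ p {l} → wR ≢ l → wL ≢ l → A⁺ p l ≡ A p l
    A⁺≡A-col p {l} wR≢l wL≢l rewrite if-≟-≢ 1 0 (≢-sym wR≢l) | if-≟-≢ 1 0 (≢-sym wL≢l) =
      trans (cong (A p l +_) (cong₂ _+_ (ℕ.*-zeroʳ (δ p bL)) (ℕ.*-zeroʳ (δ p bR)))) (ℕ.+-identityʳ (A p l))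

    A⁺≡A-row : ∀ {p} l → bL ≢ p → bR ≢ p → A⁺ p l ≡ A p l
    A⁺≡A-row {p} l bL≢p bR≢p rewrite if-≟-≢ 1 0 (≢-sym bL≢p) | if-≟-≢ 1 0 (≢-sym bR≢p) = ℕ.+-identityʳ (A p l)

  A⁺-w0 : ∀ p → NotIn3 p b0 b1 b2 → A⁺ p w0 ≡ δ p bL
  A⁺-w0 p (p≢b0 , p≢b1 , _) = trans (A⁺≡A-col p (proj₁ wR∉) (proj₁ wL∉)) (vanishing-δ col-w0 bLw0 p p≢b0 p≢b1)

  A⁺-w1 : ∀ p → NotIn3 p b0 b1 b2 → A⁺ p w1 ≡ 0
  A⁺-w1 p p∉ = trans (A⁺≡A-col p (proj₁ (proj₂ wR∉)) (proj₁ (proj₂ wL∉))) (col-w1 p p∉)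

  A⁺-w2 : ∀ p → NotIn3 p b0 b1 b2 → A⁺ p w2 ≡ δ p bR
  A⁺-w2 p (_ , p≢b1 , p≢b2) = trans (A⁺≡A-col p (proj₂ (proj₂ wR∉)) (proj₂ (proj₂ wL∉))) (vanishing-δ col-w2 bRw2 p p≢b1 p≢b2)

  A⁺-b0 : ∀ l → NotIn3 l w0 w1 w2 → A⁺ b0 l ≡ δ l wL
  A⁺-b0 l (l≢w0 , l≢w1 , _) = trans (A⁺≡A-row l (proj₁ bL∉) (proj₁ bR∉)) (vanishing-δ row-b0 b0wL l l≢w0 l≢w1)

  A⁺-b1 : ∀ l → NotIn3 l w0 w1 w2 → A⁺ b1 l ≡ 0
  A⁺-b1 l l∉ = trans (A⁺≡A-row l (proj₁ (proj₂ bL∉)) (proj₁ (proj₂ bR∉))) (row-b1 l l∉)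

  A⁺-b2 : ∀ l → NotIn3 l w0 w1 w2 → A⁺ b2 l ≡ δ l wR
  A⁺-b2 l (_ , l≢w1 , l≢w2) = trans (A⁺≡A-row l (proj₂ (proj₂ bL∉)) (proj₂ (proj₂ bR∉))) (vanishing-δ row-b2 b2wR l l≢w1 l≢w2)

  ∑-E-row : ∀ p (v : Fin n → ℕ) → ∑ n (λ l → E p l * v l) ≡ δ p bL * v wR + δ p bR * v wL
  ∑-E-row p v = begin
    ∑ n (λ l → E p l * v l)
      ≡⟨ ∑-cong n (λ l → distribute (δ p bL) (δ l wR) (δ p bR) (δ l wL) (v l)) ⟩
    ∑ n (λ l → δ p bL * (δ l wR * v l) + δ p bR * (δ l wL * v l))
      ≡⟨ ∑-distrib-+ n (λ l → δ p bL * (δ l wR * v l)) (λ l → δ p bR * (δ l wL * v l)) ⟩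
    ∑ n (λ l → δ p bL * (δ l wR * v l)) + ∑ n (λ l → δ p bR * (δ l wL * v l))
      ≡⟨ cong₂ _+_ (trans (∑-*ˡ n (δ p bL) (λ l → δ l wR * v l)) (cong (δ p bL *_) (∑-δ n wR v)))
                   (trans (∑-*ˡ n (δ p bR) (λ l → δ l wL * v l)) (cong (δ p bR *_) (∑-δ n wL v))) ⟩
    δ p bL * v wR + δ p bR * v wL ∎
    where
    distribute : ∀ a b c d x → (a * b + c * d) * x ≡ a * (b * x) + c * (d * x)
    distribute = solve-∀

  ∑-E-col : ∀ l → ∑ n (λ p → E p l) ≡ δ l wR + δ l wL
  ∑-E-col l = trans (∑-distrib-+ n (λ p → δ p bL * δ l wR) (λ p → δ p bR * δ l wL)) (cong₂ _+_ (∑-δ n bL (λ _ → δ l wR)) (∑-δ n bR (λ _ → δ l wL)))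

  ∑-A⁺-weighted : ∀ p (v : Fin n → ℕ) →
                  ∑ n (λ l → A⁺ p l * v l) ≡ ∑ n (λ l → A p l * v l) + (δ p bL * v wR + δ p bR * v wL)
  ∑-A⁺-weighted p v = trans (∑-cong n (λ l → ℕ.*-distribʳ-+ (v l) (A p l) (E p l)))
                            (trans (∑-distrib-+ n (λ l → A p l * v l) (λ l → E p l * v l)) (cong (∑ n (λ l → A p l * v l) +_) (∑-E-row p v)))

  ∑-A⁺-row : ∀ p → ∑ n (A⁺ p) ≡ 3 + (δ p bL + δ p bR)
  ∑-A⁺-row p = begin
    ∑ n (A⁺ p)                     ≡⟨ ∑-distrib-+ n (A p) (E p) ⟩
    ∑ n (A p) + ∑ n (E p)          ≡⟨ cong₂ _+_ (rowA p) (∑-cong n (λ l → sym (ℕ.*-identityʳ (E p l)))) ⟩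
    3 + ∑ n (λ l → E p l * 1)      ≡⟨ cong (3 +_) (∑-E-row p (λ _ → 1)) ⟩
    3 + (δ p bL * 1 + δ p bR * 1)  ≡⟨ cong (3 +_) (cong₂ _+_ (ℕ.*-identityʳ (δ p bL)) (ℕ.*-identityʳ (δ p bR))) ⟩
    3 + (δ p bL + δ p bR)          ∎

  ∑-A⁺-col : ∀ l → ∑ n (λ p → A⁺ p l) ≡ 3 + (δ l wL + δ l wR)
  ∑-A⁺-col l = trans (∑-distrib-+ n (λ p → A p l) (λ p → E p l))
                     (cong₂ _+_ (colA l) (trans (∑-E-col l) (ℕ.+-comm (δ l wR) (δ l wL))))

  f g : Fin m → Fin n
  f = Bs.others
  g = Ws.others

  A′ B′ : Mat m
  A′ = reduce A f g bL wR bR wL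
  B′ i j = B (f i) (g j)

  A′-regular : IsRegular m 3 A′
  A′-regular = row , col
    where
    row : ∀ i → ∑ m (λ j → A′ i j) ≡ 3
    row i = trans (∑-cong m (λ j → reduce-entry (f i) (g j))) (Ws.∑-others (A⁺ (f i)) (trans (∑-A⁺-row (f i))
              (cong (3 +_) (sym (cong₂ _+_ (A⁺-w0 (f i) f∉) (cong₂ _+_ (A⁺-w1 (f i) f∉) (A⁺-w2 (f i) f∉)))))))
      where
      f∉ : NotIn3 (f i) b0 b1 b2
      f∉ = Bs.others-∉ i
    col : ∀ j → ∑ m (λ i → A′ i j) ≡ 3
    col j = trans (∑-cong m (λ i → reduce-entry (f i) (g j))) (Bs.∑-others (λ p → A⁺ p (g j)) (trans (∑-A⁺-col (g j))
              (cong (3 +_) (sym (cong₂ _+_ (A⁺-b0 (g j) g∉) (cong₂ _+_ (A⁺-b1 (g j) g∉) (A⁺-b2 (g j) g∉)))))))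
      where
      g∉ : NotIn3 (g j) w0 w1 w2
      g∉ = Ws.others-∉ j

  B′-regular : IsRegular m (s ∸ 1) B′
  B′-regular = row , col
    where
    row : ∀ i → ∑ m (λ j → B′ i j) ≡ s ∸ 1
    row i = trans (Ws.∑-others-∸ (B (f i)) (proj₁ B-regular (f i))) (cong (s ∸_) (B-ladder-row (f i) (Bs.others-∉ i)))
    col : ∀ j → ∑ m (λ i → B′ i j) ≡ s ∸ 1
    col j = trans (Bs.∑-others-∸ (λ p → B p (g j)) (colB (g j))) (cong (s ∸_) (B-ladder-col (g j) (Ws.others-∉ j)))

  ABt-A′B′ : ∀ i i′ → ABt A′ B′ i i′ ≡ ABt A B (f i) (f i′)
  ABt-A′B′ i i′ = trans (∑-cong m (λ j → cong (_* B q (g j)) (reduce-entry p (g j))))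
                        (Ws.∑-others (λ l → A⁺ p l * B q l) (trans (∑-A⁺-weighted p (B q)) (cong (ABt A B p q +_) ladder-part)))
    where
    p q : Fin n
    p = f i
    q = f i′
    p∉ : NotIn3 p b0 b1 b2
    p∉ = Bs.others-∉ i
    q∉ : NotIn3 q b0 b1 b2
    q∉ = Bs.others-∉ i′
    ladder-part : δ p bL * B q wR + δ p bR * B q wL ≡ A⁺ p w0 * B q w0 + (A⁺ p w1 * B q w1 + A⁺ p w2 * B q w2)
    ladder-part = sym (cong₂ _+_ (cong₂ _*_ (A⁺-w0 p p∉) (sym (B-wR≡B-w0 q q∉)))
                                 (cong₂ _+_ (cong (_* B q w1) (A⁺-w1 p p∉)) (cong₂ _*_ (A⁺-w2 p p∉) (sym (B-wL≡B-w2 q q∉)))))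

  A′-zeroOne : IsZeroOne A′
  A′-zeroOne i j with (⌊ f i ≟ bL ⌋ ∧ ⌊ g j ≟ wR ⌋) ∨ (⌊ f i ≟ bR ⌋ ∧ ⌊ g j ≟ wL ⌋)
  ... | true  = inj₂ refl
  ... | false = A-zeroOne (f i) (g j)

3+-of-distinct : ∀ {n} {x y z : Fin n} → Distinct3 x y z → ∃ λ m → n ≡ 3 + m
3+-of-distinct {suc zero}          (x≢y , _)         = contradiction (Fin1-unique _ _) x≢y
3+-of-distinct {suc (suc zero)}    (x≢y , x≢z , y≢z) = contradiction (punchOut-injective x≢y x≢z (Fin1-unique _ _)) y≢z
3+-of-distinct {suc (suc (suc m))} _                 = m , refl

open import Data.Integer.Base as ℤ using (+_; 0ℤ; 1ℤ; -1ℤ)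
import Data.Integer.Properties as ℤₚ
import Data.Integer.Tactic.RingSolver as ℤ-Solver

kOf-reduce : ∀ m s → 0 < s → kOf (3 + m) 3 s ≡ kOf m 3 (s ∸ 1)
kOf-reduce m (suc s) _ = begin
  + (3 * suc s) ℤ.- + (3 + m)          ≡⟨ cong (λ a → + a ℤ.- + (3 + m)) (ℕ.*-suc 3 s) ⟩
  + (3 + 3 * s) ℤ.- + (3 + m)          ≡⟨ cong₂ ℤ._-_ (ℤₚ.pos-+ 3 (3 * s)) (ℤₚ.pos-+ 3 m) ⟩
  (+ 3 ℤ.+ + (3 * s)) ℤ.- (+ 3 ℤ.+ + m) ≡⟨ cancel (+ 3) (+ (3 * s)) (+ m) ⟩
  + (3 * s) ℤ.- + m                    ∎
  where
  open ≡-Reasoning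
  cancel : ∀ a b c → (a ℤ.+ b) ℤ.- (a ℤ.+ c) ≡ b ℤ.- c
  cancel = ℤ-Solver.solve-∀

n+kOf : ∀ n r s → + n ℤ.+ kOf n r s ≡ + (r * s)
n+kOf n r s = cancel (+ n) (+ (r * s))
  where
  cancel : ∀ a b → a ℤ.+ (b ℤ.- a) ≡ b
  cancel = ℤ-Solver.solve-∀

kOf≡1 : ∀ n s → 3 * s ≡ n + 1 → kOf n 3 s ≡ 1ℤ
kOf≡1 n s 3s≡n+1 = trans (cong (λ a → + a ℤ.- + n) 3s≡n+1) (trans (cong (ℤ._- + n) (ℤₚ.pos-+ n 1)) (cancel (+ n)))
  where
  cancel : ∀ a → a ℤ.+ 1ℤ ℤ.- a ≡ 1ℤ
  cancel = ℤ-Solver.solve-∀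

kOf≡-1 : ∀ n s → 3 * s + 1 ≡ n → kOf n 3 s ≡ -1ℤ
kOf≡-1 n s 3s+1≡n = trans (cong (λ a → + (3 * s) ℤ.- + a) (sym 3s+1≡n))
                              (trans (cong (λ a → + (3 * s) ℤ.- a) (ℤₚ.pos-+ (3 * s) 1)) (cancel (+ (3 * s))))
  where
  cancel : ∀ a → a ℤ.- (a ℤ.+ 1ℤ) ≡ -1ℤ
  cancel = ℤ-Solver.solve-∀

diagonal-bound : ∀ n s → ((3 * s ≡ n + 1) × (2 < s)) ⊎ ((3 * s + 1 ≡ n) × (1 < s)) →
                 ∃ λ D → (1ℤ ℤ.+ kOf n 3 s ≡ + D) × (2 + D < s + s) × (kOf n 3 s ≢ 0ℤ) × (0 < s)
diagonal-bound n s (inj₁ (3s≡n+1 , 2<s)) =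
  2 , cong (ℤ._+_ 1ℤ) (kOf≡1 n s 3s≡n+1) , ℕ.+-mono-< 2<s 2<s ,
  (λ k≡0 → contradiction (trans (sym (kOf≡1 n s 3s≡n+1)) k≡0) λ ()) , ℕ.≤-trans (s≤s z≤n) 2<s
diagonal-bound n s (inj₂ (3s+1≡n , 1<s)) =
  0 , cong (ℤ._+_ 1ℤ) (kOf≡-1 n s 3s+1≡n) , ℕ.+-mono-< 1<s 1<s ,
  (λ k≡0 → contradiction (trans (sym (kOf≡-1 n s 3s+1≡n)) k≡0) λ ()) , ℕ.≤-trans (s≤s z≤n) 1<s

n+k≢0 : ∀ n s → 0 < s → + n ℤ.+ kOf n 3 s ≢ 0ℤ
n+k≢0 n (suc s) _ n+k≡0 = contradiction (trans (sym (n+kOf n 3 (suc s))) n+k≡0) λ ()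

proposition3p2 :
    (n s : ℕ) (A : Mat n) →
    IsLehman n 3 s A →
    ((3 * s ≡ n + 1) × (2 < s)) ⊎ ((3 * s + 1 ≡ n) × (1 < s)) →
    (b0 b1 b2 w0 w1 w2 wL bL wR bR : Fin n) →
    IsLadder A b0 b1 b2 w0 w1 w2 →
    A b0 wL ≡ 1 → NotIn3 wL w0 w1 w2 →
    A bL w0 ≡ 1 → NotIn3 bL b0 b1 b2 →
    A b2 wR ≡ 1 → NotIn3 wR w0 w1 w2 →
    A bR w2 ≡ 1 → NotIn3 bR b0 b1 b2 →
    Σ (Fin (n ∸ 3) → Fin n) (λ f → Σ (Fin (n ∸ 3) → Fin n) (λ g →
      EnumeratesComplement f b0 b1 b2 × EnumeratesComplement g w0 w1 w2 ×
      IsLehman (n ∸ 3) 3 (s ∸ 1) (reduce A f g bL wR bR wL)))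
proposition3p2 n s A (A-zeroOne , A-regular , k-admissible , B , B-zeroOne , B-regular , ABᵀ≡J+kI) n,s-case
  b0 b1 b2 w0 w1 w2 wL bL wR bR (distinctB , distinctW , b0w0 , b1w1 , b2w2 , b0w1 , b2w1 , b1w0 , b1w2 , _)
  b0wL wL∉ bLw0 bL∉ b2wR wR∉ bRw2 bR∉
  with distinct⇒≡3+ distinctB | diagonal-bound n s n,s-case
... | m , refl | D , 1+k≡D , 2+D<s+s , k≢0 , 0<s =
  f , g , Bs.others-enumerate , Ws.others-enumerate ,
  A′-zeroOne , A′-regular , subst AdmissibleK k≡k′ k-admissible ,
  B′ , (λ i j → B-zeroOne (f i) (g j)) , B′-regular ,
  (λ i → trans (cong +_ (ABt-A′B′ i i)) (trans (proj₁ ABᵀ≡J+kI (f i)) (cong (ℤ._+_ 1ℤ) k≡k′))) ,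
  (λ i i′ i≢i′ → trans (ABt-A′B′ i i′) (proj₂ ABᵀ≡J+kI (f i) (f i′) (i≢i′ ∘ Bs.others-injective i i′)))
  where
  k≡k′ : kOf (3 + m) 3 s ≡ kOf m 3 (s ∸ 1)
  k≡k′ = kOf-reduce m s 0<s
  BᵀA≡J+kI : IsJplusKI (3 + m) (kOf (3 + m) 3 s) (flip B) (flip A)
  BᵀA≡J+kI = transpose-J+kI {A = A} {B} A-regular ABᵀ≡J+kI k≢0 (n+k≢0 (3 + m) s 0<s)
  open LadderReduction {A = A} {B} A-zeroOne A-regular B-regular
         (λ p → ℤₚ.+-injective (trans (proj₁ ABᵀ≡J+kI p) 1+k≡D)) (proj₂ ABᵀ≡J+kI) (proj₂ BᵀA≡J+kI) 2+D<s+s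
         distinctB distinctW b0w0 b1w1 b2w2 b0w1 b2w1 b1w0 b1w2 b0wL wL∉ bLw0 bL∉ b2wR wR∉ bRw2 bR∉
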